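{- Let $\mathcal{P}$ be a strongly regular U-poset and let $A=\{a_1,\dots,a_m\}$, $B=\{b_1,\dots,b_m\}$ ($m\ge1$) be subsets of $\mathcal{P}$ such that $a_i\le b_j$ if and only if $i=j$. Let $k_i=r(a_i)$, $l_i=r(b_i)$. Then $$\sum_{i=1}^m\beta(k_i,l_i)+\sum_{x\in\mathcal{U}(A)\setminus\mathcal{D}(B)}\frac{W_A(x)}{d^-_{r(x)}N_{r(x)}}=1,$$ where $$\beta(k_i,l_i)=\sum_{j=0}^{l_i-k_i}\frac{\lambda_{k_i+j}(k_i,l_i)}{d^-_{k_i+j}N_{k_i+j}}\left(d^-_{k_i+j}-\lambda_{k_i+j-1}(k_i,k_i+j)\right),$$ and, if $k_i=0$, the $j=0$ summand of $\beta(k_i,l_i)$ is interpreted as $1$.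
   Context: All posets are finite. A poset $\mathcal{P}$ is ranked with rank function $r$ if every minimal element has rank $0$ and $r(b)=r(a)+1$ whenever $b$ covers $a$; $\mathcal{P}_i$ is the set of elements of rank $i$ and $N_i=|\mathcal{P}_i|$. $\mathcal{P}$ is regular if for every element $a$ both the number of elements covering $a$ and the number of elements covered by $a$ depend only on $r(a)$; $d^-_i$ is the number of elements covered by an element of rank $i$ ($d^-_0=0$). A U-poset has a unique minimum and unique maximum. For $a\in\mathcal{P}$: $\Gamma^+_i(a)=\{x\in\mathcal{P}_i:x\ge a\}$, $\Gamma^-_i(a)=\{x\in\mathcal{P}_i:x\le a\}$, $\Gamma^-(x)=\Gamma^-_{r(x)-1}(x)$; for a set $S$, $\Gamma^+_i(S)=\bigcup_{s\in S}\Gamma^+_i(s)$. A U-poset is strongly regular if for all $a<b$ in $\mathcal{P}$ the number $|\Gamma^+_i(a)\cap\Gamma^-_i(b)|$ depends only on $i$, $r(a)$, $r(b)$; then $\lambda_i(k,l)$ denotes this number for $r(a)=k$, $r(b)=l$, $k\le i\le l$, and $\lambda_i(k,l)=0$ for all other integer triples. $\mathcal{U}(A)=\{x: x\ge a\text{ for some }a\in A\}$, $\mathcal{D}(B)=\{x:x\le b\text{ for some }b\in B\}$. $A^x=\{a\in A:a\le x\}$; $W_A(x)=0$ if $A^x=\emptyset$, else $W_A(x)=|\Gamma^-(x)\setminus\Gamma^+_{r(x)-1}(A^x)|$. -}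

module Defs where

open import Level using (0ℓ)
open import Data.Nat as ℕ using (ℕ; zero; suc; _+_; _*_; _∸_; _≤_; _<_)
open import Data.Integer using (+_)
open import Data.Rational using (ℚ; 0ℚ; 1ℚ; _/_) renaming (_+_ to _+ℚ_; _*_ to _*ℚ_; _-_ to _-ℚ_)
open import Data.Fin using (Fin)
open import Data.Fin.Properties using (any?; all?)
open import Data.List using (List; length; filter; map; foldr; allFin; upTo)
open import Data.Product using (Σ; ∃; _×_; _,_)
open import Data.Sum using (_⊎_)
open import Relation.Nullary using (¬_; Dec; yes; no)
open import Relation.Nullary.Decidable using (_×-dec_; ¬?)
open import Relation.Unary using (Pred)
import Relation.Unary as U
open import Relation.Binary using (Rel; IsPartialOrder)
import Relation.Binary as B
open import Relation.Binary.PropositionalEquality using (_≡_; _≢_)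
open import Data.Fin.Properties using (_≟_)

record FinPoset : Set₁ where
  field
    n : ℕ
    _≼_ : Rel (Fin n) 0ℓ
    _≼?_ : B.Decidable _≼_
    isPartialOrder : IsPartialOrder _≡_ _≼_

count : ∀ {n} {P : Pred (Fin n) 0ℓ} → U.Decidable P → ℕ
count {n} P? = length (filter P? (allFin n))

sumℚ : List ℚ → ℚ
sumℚ = foldr _+ℚ_ 0ℚ

ℕ→ℚ : ℕ → ℚ
ℕ→ℚ k = + k / 1

-- division of a rational by a natural number; convention p / 0 = 0
-- (only ever applied to denominators that are nonzero, or with numerator 0)
_/ℕ_ : ℚ → ℕ → ℚ
p /ℕ zero = 0ℚ
p /ℕ suc k = p *ℚ (+ 1 / suc k)

module _ (P : FinPoset) where
  open FinPoset P

  Elt : Set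
  Elt = Fin n

  _≺_ : Elt → Elt → Set
  a ≺ b = a ≼ b × a ≢ b

  _≺?_ : B.Decidable _≺_
  a ≺? b = (a ≼? b) ×-dec ¬? (a ≟ b)

  _⋖_ : Elt → Elt → Set
  a ⋖ b = a ≺ b × (∀ c → ¬ (a ≺ c × c ≺ b))

  _⋖?_ : B.Decidable _⋖_
  a ⋖? b = (a ≺? b) ×-dec all? (λ c → ¬? ((a ≺? c) ×-dec (c ≺? b)))

  Minimal : Elt → Set
  Minimal a = ∀ x → x ≼ a → x ≡ a

  IsRankFunction : (Elt → ℕ) → Set
  IsRankFunction r = (∀ a → Minimal a → r a ≡ 0)
                   × (∀ a b → a ⋖ b → r b ≡ suc (r a))

  IsUPoset : Set
  IsUPoset = (Σ Elt λ z → ∀ x → z ≼ x) × (Σ Elt λ t → ∀ x → x ≼ t)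

  upDeg : Elt → ℕ
  upDeg a = count (λ x → a ⋖? x)

  downDeg : Elt → ℕ
  downDeg a = count (λ x → x ⋖? a)

  module Ranked (r : Elt → ℕ) where

    N : ℕ → ℕ
    N i = count (λ x → r x ℕ.≟ i)

    IsRegularWith : (ℕ → ℕ) → Set
    IsRegularWith d⁻ = (∀ a b → r a ≡ r b → upDeg a ≡ upDeg b)
                     × (∀ a → downDeg a ≡ d⁻ (r a))

    interval : ℕ → Elt → Elt → ℕ
    interval i a b = count (λ x → (r x ℕ.≟ i) ×-dec ((a ≼? x) ×-dec (x ≼? b)))

    -- strongly regular with parameters λ(i,k,l) = λ_i(k,l)
    -- (λ_i(k,l) = 0 unless k ≤ i ≤ l)
    IsStronglyRegularWith : (ℕ → ℕ → ℕ → ℕ) → Set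
    IsStronglyRegularWith λ' =
        (∀ a b → a ≼ b → ∀ i → r a ≤ i → i ≤ r b → interval i a b ≡ λ' i (r a) (r b))
      × (∀ i k l → (i < k ⊎ l < i) → λ' i k l ≡ 0)

    module Sets {m : ℕ} (A B : Fin m → Elt) where

      inUp? : U.Decidable (λ x → ∃ λ i → A i ≼ x)
      inUp? x = any? (λ i → A i ≼? x)

      inDown? : U.Decidable (λ x → ∃ λ i → x ≼ B i)
      inDown? x = any? (λ i → x ≼? B i)

      W : Elt → ℕ
      W x with inUp? x
      ... | no _ = 0
      ... | yes _ = count (λ y → ((y ≼? x) ×-dec (suc (r y) ℕ.≟ r x))
                               ×-dec ¬? (any? (λ i → (A i ≼? x) ×-dec (A i ≼? y))))

      inDiff? : U.Decidable (λ x → (∃ λ i → A i ≼ x) × ¬ (∃ λ i → x ≼ B i))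
      inDiff? x = inUp? x ×-dec ¬? (inDown? x)

      weightSum : (ℕ → ℕ) → ℚ
      weightSum d⁻ = sumℚ (map (λ x → ℕ→ℚ (W x) /ℕ (d⁻ (r x) * N (r x)))
                               (filter inDiff? (allFin n)))

    βterm : (ℕ → ℕ) → (ℕ → ℕ → ℕ → ℕ) → ℕ → ℕ → ℕ → ℚ
    βterm d⁻ λ' zero l zero = 1ℚ
    βterm d⁻ λ' (suc k') l zero =
      (ℕ→ℚ (λ' (suc k') (suc k') l) /ℕ (d⁻ (suc k') * N (suc k')))
        *ℚ (ℕ→ℚ (d⁻ (suc k')) -ℚ ℕ→ℚ (λ' k' (suc k') (suc k')))
    βterm d⁻ λ' k l (suc j) =
      (ℕ→ℚ (λ' (k + suc j) k l) /ℕ (d⁻ (k + suc j) * N (k + suc j)))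
        *ℚ (ℕ→ℚ (d⁻ (k + suc j)) -ℚ ℕ→ℚ (λ' (k + j) k (k + suc j)))

    β : (ℕ → ℕ) → (ℕ → ℕ → ℕ → ℕ) → ℕ → ℕ → ℚ
    β d⁻ λ' k l = sumℚ (map (βterm d⁻ λ' k l) (upTo (suc (l ∸ k))))

module Submission where

-- Idea: a conserved flow of mass.  Give each element of rank i the share 1/N_i
-- and let every element send its share upwards, split evenly among its upper
-- covers; by regularity an element of rank i then receives ω_i = 1/(d⁻_i N_i)
-- through each lower cover.  For a nonempty up-set S, comparing the total share
-- of S at the receiving and at the sending ends shows that the mass entering S
-- from outside (the leak), plus 1 if S contains the bottom, is the 1 leaving at
-- the top (Flow.flow).  For S = U(A) the leak at x is W_A(x) ω_{r x}.  Finally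
-- U(A) is the disjoint union of U(A) ∖ D(B) and the intervals [A i, B i]; by
-- strong regularity the leak over [A i, B i], taken rank by rank, is
-- β(k_i, l_i) apart from the convention for k_i = 0, and these corrections add
-- up to the indicator of bottom ∈ U(A).

open import Defs
open import Data.Nat using (ℕ; suc; _≤_)
open import Data.Fin using (Fin)
open import Data.Rational using (ℚ; 1ℚ; _+_)
open import Data.List using (map; allFin)
open import Relation.Binary.PropositionalEquality using (_≡_)
open import Function.Bundles using (_⇔_)

open import Level using (0ℓ)
open import Algebra.Bundles using (CommutativeRing)
open import Data.Bool using (if_then_else_)
open import Data.Empty using (⊥-elim)
open import Data.Fin using (zero; suc; toℕ; fromℕ<)
import Data.Fin.Properties as Finₚ
open import Data.Fin.Properties using (any?)
import Data.Integer as ℤ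
import Data.Integer.Properties as ℤₚ
open import Data.List using ([]; _∷_; filter; length; tabulate; upTo; applyUpTo)
open import Data.List.Properties using (map-tabulate; map-upTo; filter-some)
open import Data.List.Membership.Propositional.Properties using (∈-allFin)
import Data.List.Relation.Unary.Any as Any
import Data.Nat as ℕ
open import Data.Nat using (zero; _<_; NonZero)
open import Data.Nat.Induction using (<-wellFounded)
import Data.Nat.Coprimality as Coprime
import Data.Nat.Properties as ℕₚ
open import Data.Product using (∃; _×_; _,_; proj₁; proj₂)
open import Data.Rational using (0ℚ; mkℚ; ↥_; _*_; _-_; toℚᵘ)
open import Data.Rational.Properties
open import Data.Rational.Solver using (module +-*-Solver)
import Data.Rational.Unnormalised as ℚᵘ
import Data.Rational.Unnormalised.Properties as ℚᵘₚ
open import Data.Sum using (inj₁; inj₂)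
open import Function using (_∘_; case_of_)
open import Function.Bundles using (Equivalence)
open import Induction.WellFounded using (Acc; acc)
open import Relation.Binary using (IsPartialOrder)
open import Relation.Binary.PropositionalEquality
  using (refl; sym; trans; cong; cong₂; subst; subst₂; module ≡-Reasoning)
open import Relation.Nullary using (Dec; yes; no; ¬_; does)
open import Relation.Nullary.Decidable using (_×-dec_; ¬?)
open import Relation.Unary using (Pred)
import Relation.Unary as U

open import Algebra.Properties.Semiring.Sum (CommutativeRing.semiring +-*-commutativeRing)
  using (sum; sum-syntax; sum-cong-≗; sum-replicate-zero; ∑-distrib-+; ∑-comm; *-distribˡ-sum; *-distribʳ-sum)

ℕ→ℚ-reduced : ∀ k → ℕ→ℚ k ≡ mkℚ (ℤ.+ k) 0 (Coprime.sym (Coprime.1-coprimeTo k))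
ℕ→ℚ-reduced k = normalize-coprime (Coprime.sym (Coprime.1-coprimeTo k))

ℕ→ℚ-injective : ∀ {a b} → ℕ→ℚ a ≡ ℕ→ℚ b → a ≡ b
ℕ→ℚ-injective {a} {b} eq =
  ℤₚ.+-injective (cong ↥_ (trans (sym (ℕ→ℚ-reduced a)) (trans eq (ℕ→ℚ-reduced b))))

toℚᵘ-ℕ→ℚ : ∀ k → toℚᵘ (ℕ→ℚ k) ≡ ℚᵘ.mkℚᵘ (ℤ.+ k) 0
toℚᵘ-ℕ→ℚ k = cong toℚᵘ (ℕ→ℚ-reduced k)

ℕ→ℚ-+ : ∀ a b → ℕ→ℚ (a ℕ.+ b) ≡ ℕ→ℚ a + ℕ→ℚ b
ℕ→ℚ-+ a b = toℚᵘ-injective (begin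
    toℚᵘ (ℕ→ℚ (a ℕ.+ b))                           ≈⟨ ℚᵘₚ.≃-reflexive (toℚᵘ-ℕ→ℚ (a ℕ.+ b)) ⟩
    ℚᵘ.mkℚᵘ (ℤ.+ (a ℕ.+ b)) 0                        ≈⟨ ℚᵘ.*≡* numerators ⟩
    ℚᵘ.mkℚᵘ (ℤ.+ a) 0 ℚᵘ.+ ℚᵘ.mkℚᵘ (ℤ.+ b) 0           ≈⟨ ℚᵘₚ.≃-reflexive (sym (cong₂ ℚᵘ._+_ (toℚᵘ-ℕ→ℚ a) (toℚᵘ-ℕ→ℚ b))) ⟩
    toℚᵘ (ℕ→ℚ a) ℚᵘ.+ toℚᵘ (ℕ→ℚ b)                 ≈⟨ ℚᵘₚ.≃-sym (toℚᵘ-homo-+ (ℕ→ℚ a) (ℕ→ℚ b)) ⟩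
    toℚᵘ (ℕ→ℚ a + ℕ→ℚ b)                           ∎)
  where
  open ℚᵘₚ.≃-Reasoning
  numerators : ℤ.+ (a ℕ.+ b) ℤ.* ℤ.+ 1 ≡ (ℤ.+ a ℤ.* ℤ.+ 1 ℤ.+ ℤ.+ b ℤ.* ℤ.+ 1) ℤ.* ℤ.+ 1
  numerators = trans (ℤₚ.*-identityʳ _) (trans (ℤₚ.pos-+ a b) (sym (trans (ℤₚ.*-identityʳ _)
                 (cong₂ ℤ._+_ (ℤₚ.*-identityʳ (ℤ.+ a)) (ℤₚ.*-identityʳ (ℤ.+ b))))))

ℕ→ℚ-* : ∀ a b → ℕ→ℚ (a ℕ.* b) ≡ ℕ→ℚ a * ℕ→ℚ b
ℕ→ℚ-* a b = toℚᵘ-injective (begin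
    toℚᵘ (ℕ→ℚ (a ℕ.* b))                           ≈⟨ ℚᵘₚ.≃-reflexive (toℚᵘ-ℕ→ℚ (a ℕ.* b)) ⟩
    ℚᵘ.mkℚᵘ (ℤ.+ (a ℕ.* b)) 0                        ≈⟨ ℚᵘ.*≡* (cong (ℤ._* ℤ.+ 1) (ℤₚ.pos-* a b)) ⟩
    ℚᵘ.mkℚᵘ (ℤ.+ a) 0 ℚᵘ.* ℚᵘ.mkℚᵘ (ℤ.+ b) 0           ≈⟨ ℚᵘₚ.≃-reflexive (sym (cong₂ ℚᵘ._*_ (toℚᵘ-ℕ→ℚ a) (toℚᵘ-ℕ→ℚ b))) ⟩
    toℚᵘ (ℕ→ℚ a) ℚᵘ.* toℚᵘ (ℕ→ℚ b)                 ≈⟨ ℚᵘₚ.≃-sym (toℚᵘ-homo-* (ℕ→ℚ a) (ℕ→ℚ b)) ⟩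
    toℚᵘ (ℕ→ℚ a * ℕ→ℚ b)                           ∎)
  where open ℚᵘₚ.≃-Reasoning

+-move-right : ∀ {a b c} → a + b ≡ c → a ≡ c - b
+-move-right {a} {b} refl = solve 2 (λ a b → a := a :+ b :- b) refl a b
  where open +-*-Solver

-- inv k is 1/k, with the convention 1/0 = 0 of _/ℕ_.
inv : ℕ → ℚ
inv k = 1ℚ /ℕ k

/ℕ-as-* : ∀ p k → p /ℕ k ≡ p * inv k
/ℕ-as-* p zero    = sym (*-zeroʳ p)
/ℕ-as-* p (suc k) = cong (p *_) (sym (*-identityˡ _))

ℕ→ℚ-inverse : ∀ k → ℕ→ℚ (suc k) * inv (suc k) ≡ 1ℚ
ℕ→ℚ-inverse k =
  trans (cong₂ _*_ (ℕ→ℚ-reduced (suc k)) (trans (*-identityˡ _) (normalize-coprime (Coprime.1-coprimeTo (suc k)))))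
        (*-inverseʳ (mkℚ (ℤ.+ suc k) 0 (Coprime.sym (Coprime.1-coprimeTo (suc k)))))

-- A nonzero factor a cancels: a · 1/(a·b) = 1/b (also for b = 0, where both sides vanish).
inv-cancelˡ : ∀ a b → .{{NonZero a}} → ℕ→ℚ a * inv (a ℕ.* b) ≡ inv b
inv-cancelˡ (suc a) zero =
  trans (cong (λ w → ℕ→ℚ (suc a) * inv w) (ℕₚ.*-zeroʳ (suc a))) (*-zeroʳ (ℕ→ℚ (suc a)))
inv-cancelˡ (suc a) (suc b) = begin
    X * u               ≡⟨ sym (*-identityʳ (X * u)) ⟩
    X * u * 1ℚ          ≡⟨ cong (X * u *_) (sym (ℕ→ℚ-inverse b)) ⟩
    X * u * (Y * v)     ≡⟨ regroup X u Y v ⟩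
    X * Y * u * v       ≡⟨ cong (λ w → w * u * v) (sym (ℕ→ℚ-* (suc a) (suc b))) ⟩
    ℕ→ℚ (suc a ℕ.* suc b) * u * v ≡⟨ cong (_* v) (ℕ→ℚ-inverse (b ℕ.+ a ℕ.* suc b)) ⟩
    1ℚ * v              ≡⟨ *-identityˡ v ⟩
    v                   ∎
  where
  open ≡-Reasoning
  open +-*-Solver
  X Y u v : ℚ
  X = ℕ→ℚ (suc a)
  Y = ℕ→ℚ (suc b)
  u = inv (suc a ℕ.* suc b)
  v = inv (suc b)
  regroup : ∀ X u Y v → X * u * (Y * v) ≡ X * Y * u * v
  regroup = solve 4 (λ X u Y v → X :* u :* (Y :* v) := X :* Y :* u :* v) refl

private variable Φ Ψ Φ′ Ψ′ : Set

𝟙 : Dec Φ → ℚ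
𝟙 d = if does d then 1ℚ else 0ℚ

𝟙-yes : (d : Dec Φ) → Φ → 𝟙 d ≡ 1ℚ
𝟙-yes (yes _) _  = refl
𝟙-yes (no ¬p) p = ⊥-elim (¬p p)

𝟙-no : (d : Dec Φ) → ¬ Φ → 𝟙 d ≡ 0ℚ
𝟙-no (yes p) ¬p = ⊥-elim (¬p p)
𝟙-no (no _)  _  = refl

𝟙-cong : (d : Dec Φ) (e : Dec Ψ) → (Φ → Ψ) → (Ψ → Φ) → 𝟙 d ≡ 𝟙 e
𝟙-cong (yes p) e f g = sym (𝟙-yes e (f p))
𝟙-cong (no ¬p) e f g = sym (𝟙-no e (¬p ∘ g))

𝟙-guard : (d : Dec Φ) {a b : ℚ} → (Φ → a ≡ b) → 𝟙 d * a ≡ 𝟙 d * b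
𝟙-guard (yes p) eq = cong (1ℚ *_) (eq p)
𝟙-guard (no _) {a} {b} _ = trans (*-zeroˡ a) (sym (*-zeroˡ b))

𝟙-absorb : (d : Dec Φ) {c : ℚ} (a : ℚ) → (Φ → c ≡ 1ℚ) → c * (𝟙 d * a) ≡ 𝟙 d * a
𝟙-absorb (yes p) a c≡1 = trans (cong (_* (1ℚ * a)) (c≡1 p)) (*-identityˡ _)
𝟙-absorb (no _) {c} a _ = trans (cong (c *_) (*-zeroˡ a)) (trans (*-zeroʳ c) (sym (*-zeroˡ a)))

𝟙-× : (d : Dec Φ) (e : Dec Ψ) → 𝟙 (d ×-dec e) ≡ 𝟙 d * 𝟙 e
𝟙-× (yes _) (yes _) = refl
𝟙-× (yes _) (no _)  = refl
𝟙-× (no _)  (yes _) = refl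
𝟙-× (no _)  (no _)  = refl

𝟙-split : (d : Dec Φ) (e : Dec Ψ) → 𝟙 (d ×-dec ¬? e) + 𝟙 (d ×-dec e) ≡ 𝟙 d
𝟙-split (yes _) (yes _) = refl
𝟙-split (yes _) (no _)  = refl
𝟙-split (no _)  (yes _) = refl
𝟙-split (no _)  (no _)  = refl

𝟙-×-cong : (d : Dec Φ) (e : Dec Ψ) (d′ : Dec Φ′) (e′ : Dec Ψ′) →
  (Φ × Ψ → Φ′ × Ψ′) → (Φ′ × Ψ′ → Φ × Ψ) → 𝟙 d * 𝟙 e ≡ 𝟙 d′ * 𝟙 e′
𝟙-×-cong d e d′ e′ f g = trans (sym (𝟙-× d e)) (trans (𝟙-cong (d ×-dec e) (d′ ×-dec e′) f g) (𝟙-× d′ e′))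

∑-zero : ∀ {n} {f : Fin n → ℚ} → (∀ i → f i ≡ 0ℚ) → sum f ≡ 0ℚ
∑-zero {n} f≡0 = trans (sum-cong-≗ f≡0) (sum-replicate-zero n)

∑-single : ∀ {n} (f : Fin n → ℚ) (i : Fin n) → (∀ j → ¬ j ≡ i → f j ≡ 0ℚ) → sum f ≡ f i
∑-single f zero off =
  trans (cong (f zero +_) (∑-zero (λ j → off (suc j) λ ()))) (+-identityʳ (f zero))
∑-single f (suc i) off =
  trans (cong (_+ sum (f ∘ suc)) (off zero λ ()))
        (trans (+-identityˡ _) (∑-single (f ∘ suc) i (λ j j≢i → off (suc j) (j≢i ∘ Finₚ.suc-injective))))

∑-split : ∀ {n} (w f g : Fin n → ℚ) →
  ∑[ x < n ] (w x * (f x + g x)) ≡ ∑[ x < n ] (w x * f x) + ∑[ x < n ] (w x * g x)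
∑-split w f g = trans (sum-cong-≗ (λ x → *-distribˡ-+ (w x) (f x) (g x)))
                      (∑-distrib-+ (λ x → w x * f x) (λ x → w x * g x))

∑-point : ∀ {n} (f : Fin n → ℚ) (c : Fin n) → ∑[ x < n ] (f x * 𝟙 (x Finₚ.≟ c)) ≡ f c
∑-point f c = trans (∑-single (λ x → f x * 𝟙 (x Finₚ.≟ c)) c
                      (λ x x≢c → trans (cong (f x *_) (𝟙-no (x Finₚ.≟ c) x≢c)) (*-zeroʳ (f x))))
                    (trans (cong (f c *_) (𝟙-yes (c Finₚ.≟ c) refl)) (*-identityʳ (f c)))

sumℚ-tabulate : ∀ {n} (f : Fin n → ℚ) → sumℚ (tabulate f) ≡ sum f
sumℚ-tabulate {zero}  f = refl
sumℚ-tabulate {suc n} f = cong (f zero +_) (sumℚ-tabulate (f ∘ suc))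

sumℚ-allFin : ∀ {n} (f : Fin n → ℚ) → sumℚ (map f (allFin n)) ≡ sum f
sumℚ-allFin f = trans (cong sumℚ (map-tabulate (λ i → i) f)) (sumℚ-tabulate f)

sumℚ-upTo : ∀ (f : ℕ → ℚ) L → sumℚ (map f (upTo L)) ≡ ∑[ j < L ] f (toℕ j)
sumℚ-upTo f L = trans (cong sumℚ (map-upTo f L)) (applyUpTo-sum f L)
  where
  applyUpTo-sum : ∀ (f : ℕ → ℚ) L → sumℚ (applyUpTo f L) ≡ ∑[ j < L ] f (toℕ j)
  applyUpTo-sum f zero    = refl
  applyUpTo-sum f (suc L) = cong (f 0 +_) (applyUpTo-sum (f ∘ suc) L)

∑-hit : ∀ {k s L} → k ≤ s → s ≤ k ℕ.+ L → ∑[ j < suc L ] 𝟙 (s ℕ.≟ k ℕ.+ toℕ j) ≡ 1ℚ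
∑-hit {k} {s} {L} k≤s s≤k+L =
  trans (∑-single (λ j → 𝟙 (s ℕ.≟ k ℕ.+ toℕ j)) j₀ (λ j j≢j₀ → 𝟙-no (s ℕ.≟ k ℕ.+ toℕ j) (j≢j₀ ∘ offset-unique)))
        (𝟙-yes (s ℕ.≟ k ℕ.+ toℕ j₀) (sym (trans (cong (k ℕ.+_) (Finₚ.toℕ-fromℕ< offset<)) (ℕₚ.m+[n∸m]≡n k≤s))))
  where
  offset< : s ℕ.∸ k < suc L
  offset< = ℕ.s≤s (subst (s ℕ.∸ k ≤_) (ℕₚ.m+n∸m≡n k L) (ℕₚ.∸-monoˡ-≤ k s≤k+L))
  j₀ : Fin (suc L)
  j₀ = fromℕ< offset<
  offset-unique : ∀ {j} → s ≡ k ℕ.+ toℕ j → j ≡ j₀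
  offset-unique {j} s≡ = Finₚ.toℕ-injective (trans (sym (trans (cong (ℕ._∸ k) s≡) (ℕₚ.m+n∸m≡n k (toℕ j))))
                                                   (sym (Finₚ.toℕ-fromℕ< offset<)))

module _ {A : Set} {P : Pred A 0ℓ} (P? : U.Decidable P) where

  sumℚ-filter-list : ∀ (f : A → ℚ) xs → sumℚ (map f (filter P? xs)) ≡ sumℚ (map (λ x → 𝟙 (P? x) * f x) xs)
  sumℚ-filter-list f []       = refl
  sumℚ-filter-list f (x ∷ xs) with P? x
  ... | yes _ = cong₂ _+_ (sym (*-identityˡ (f x))) (sumℚ-filter-list f xs)
  ... | no _  = trans (sumℚ-filter-list f xs) (sym (trans (cong (_+ _) (*-zeroˡ (f x))) (+-identityˡ _)))

  length-filter-list : ∀ xs → ℕ→ℚ (length (filter P? xs)) ≡ sumℚ (map (λ x → 𝟙 (P? x)) xs)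
  length-filter-list []       = refl
  length-filter-list (x ∷ xs) with P? x
  ... | yes _ = trans (ℕ→ℚ-+ 1 (length (filter P? xs))) (cong (1ℚ +_) (length-filter-list xs))
  ... | no _  = trans (length-filter-list xs) (sym (+-identityˡ _))

sumℚ-filter : ∀ {n} {P : Pred (Fin n) 0ℓ} (P? : U.Decidable P) (f : Fin n → ℚ) →
  sumℚ (map f (filter P? (allFin n))) ≡ ∑[ x < n ] (𝟙 (P? x) * f x)
sumℚ-filter {n} P? f = trans (sumℚ-filter-list P? f (allFin n)) (sumℚ-allFin (λ x → 𝟙 (P? x) * f x))

count-∑ : ∀ {n} {P : Pred (Fin n) 0ℓ} (P? : U.Decidable P) → ℕ→ℚ (count P?) ≡ ∑[ x < n ] 𝟙 (P? x)
count-∑ {n} P? = trans (length-filter-list P? (allFin n)) (sumℚ-allFin (λ x → 𝟙 (P? x)))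

∑-constant-on : ∀ {n} {P : Pred (Fin n) 0ℓ} (P? : U.Decidable P) (f : Fin n → ℚ) (c : ℚ) →
  (∀ x → P x → f x ≡ c) → ∑[ x < n ] (𝟙 (P? x) * f x) ≡ ℕ→ℚ (count P?) * c
∑-constant-on {n} P? f c f≡c = begin
    ∑[ x < n ] (𝟙 (P? x) * f x)   ≡⟨ sum-cong-≗ (λ x → 𝟙-guard (P? x) (f≡c x)) ⟩
    ∑[ x < n ] (𝟙 (P? x) * c)    ≡⟨ sym (*-distribʳ-sum c (λ x → 𝟙 (P? x))) ⟩
    (∑[ x < n ] 𝟙 (P? x)) * c   ≡⟨ cong (_* c) (sym (count-∑ P?)) ⟩
    ℕ→ℚ (count P?) * c          ∎
  where open ≡-Reasoning

module _ {n : ℕ} {P : Pred (Fin n) 0ℓ} (P? : U.Decidable P) where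

  count-cong : {Q : Pred (Fin n) 0ℓ} (Q? : U.Decidable Q) →
    (∀ x → P x → Q x) → (∀ x → Q x → P x) → count P? ≡ count Q?
  count-cong Q? P⇒Q Q⇒P = ℕ→ℚ-injective (trans (count-∑ P?)
    (trans (sum-cong-≗ (λ x → 𝟙-cong (P? x) (Q? x) (P⇒Q x) (Q⇒P x))) (sym (count-∑ Q?))))

  count-none : (∀ x → ¬ P x) → count P? ≡ 0
  count-none none = ℕ→ℚ-injective (trans (count-∑ P?) (∑-zero (λ x → 𝟙-no (P? x) (none x))))

  count-unique : (c : Fin n) → P c → (∀ x → P x → x ≡ c) → count P? ≡ 1
  count-unique c pc unique = ℕ→ℚ-injective (trans (count-∑ P?)
    (trans (∑-single _ c (λ x x≢c → 𝟙-no (P? x) (x≢c ∘ unique x))) (𝟙-yes (P? c) pc)))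

  count-some : (c : Fin n) → P c → 0 < count P?
  count-some c pc = filter-some P? (Any.map (λ { refl → pc }) (∈-allFin c))

  count-split : {Q : Pred (Fin n) 0ℓ} (Q? : U.Decidable Q) →
    count (λ x → P? x ×-dec ¬? (Q? x)) ℕ.+ count (λ x → P? x ×-dec Q? x) ≡ count P?
  count-split {Q} Q? = ℕ→ℚ-injective (begin
      ℕ→ℚ (count P∖Q ℕ.+ count P∩Q)                    ≡⟨ ℕ→ℚ-+ (count P∖Q) (count P∩Q) ⟩
      ℕ→ℚ (count P∖Q) + ℕ→ℚ (count P∩Q)                ≡⟨ cong₂ _+_ (count-∑ P∖Q) (count-∑ P∩Q) ⟩
      ∑[ x < n ] 𝟙 (P∖Q x) + ∑[ x < n ] 𝟙 (P∩Q x)     ≡⟨ sym (∑-distrib-+ (λ x → 𝟙 (P∖Q x)) (λ x → 𝟙 (P∩Q x))) ⟩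
      ∑[ x < n ] (𝟙 (P∖Q x) + 𝟙 (P∩Q x))              ≡⟨ sum-cong-≗ (λ x → 𝟙-split (P? x) (Q? x)) ⟩
      ∑[ x < n ] 𝟙 (P? x)                             ≡⟨ sym (count-∑ P?) ⟩
      ℕ→ℚ (count P?)                                 ∎)
    where
    open ≡-Reasoning
    P∖Q : ∀ x → Dec (P x × ¬ Q x)
    P∖Q x = P? x ×-dec ¬? (Q? x)
    P∩Q : ∀ x → Dec (P x × Q x)
    P∩Q x = P? x ×-dec Q? x

count-strict : ∀ {n} {P Q : Pred (Fin n) 0ℓ} (P? : U.Decidable P) (Q? : U.Decidable Q) →
  (∀ x → Q x → P x) → (w : Fin n) → P w → ¬ Q w → count Q? < count P?
count-strict P? Q? Q⇒P w pw ¬qw = subst₂ _<_ count-Q (count-split P? Q?)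
  (ℕₚ.+-monoˡ-< (count (λ x → P? x ×-dec Q? x)) (count-some (λ x → P? x ×-dec ¬? (Q? x)) w (pw , ¬qw)))
  where
  count-Q : count (λ x → P? x ×-dec Q? x) ≡ count Q?
  count-Q = count-cong (λ x → P? x ×-dec Q? x) Q? (λ _ → proj₂) (λ x qx → Q⇒P x qx , qx)

module PosetFacts (P : FinPoset) where
  open FinPoset P public
  open IsPartialOrder isPartialOrder public using (antisym)
    renaming (refl to ≼-refl; trans to ≼-trans; reflexive to ≼-reflexive)

  infix 4 _≺ₚ_ _⋖ₚ_ _≺?ₚ_ _⋖?ₚ_

  _≺ₚ_ : Elt P → Elt P → Set
  _≺ₚ_ = _≺_ P

  _⋖ₚ_ : Elt P → Elt P → Set
  _⋖ₚ_ = _⋖_ P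

  _≺?ₚ_ : ∀ a b → Dec (a ≺ₚ b)
  _≺?ₚ_ = _≺?_ P

  _⋖?ₚ_ : ∀ a b → Dec (a ⋖ₚ b)
  _⋖?ₚ_ = _⋖?_ P

  ⋖⇒≼ : ∀ {a b} → a ⋖ₚ b → a ≼ b
  ⋖⇒≼ = proj₁ ∘ proj₁

  ≺-irrefl : ∀ {a b} → a ≺ₚ b → ¬ b ≼ a
  ≺-irrefl (a≼b , a≢b) b≼a = a≢b (antisym a≼b b≼a)

  -- Going strictly up shrinks the up-set, going strictly down shrinks the
  -- down-set; these measures make the searches for covers below terminate.
  above below : Elt P → ℕ
  above a = count (a ≼?_)
  below b = count (_≼? b)

  above-shrinks : ∀ {a c} → a ≺ₚ c → above c < above a
  above-shrinks {a} {c} a≺c =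
    count-strict (a ≼?_) (c ≼?_) (λ x c≼x → ≼-trans (proj₁ a≺c) c≼x) a ≼-refl (≺-irrefl a≺c)

  below-shrinks : ∀ {c b} → c ≺ₚ b → below c < below b
  below-shrinks {c} {b} c≺b =
    count-strict (_≼? b) (_≼? c) (λ x x≼c → ≼-trans x≼c (proj₁ c≺b)) b ≼-refl (≺-irrefl c≺b)

  lower-cover : ∀ {a b} → a ≺ₚ b → ∃ λ c → a ≼ c × c ⋖ₚ b
  lower-cover {a} {b} = go a (<-wellFounded (above a))
    where
    go : ∀ a → Acc _<_ (above a) → a ≺ₚ b → ∃ λ c → a ≼ c × c ⋖ₚ b
    go a (acc smaller) a≺b with any? (λ c → (a ≺?ₚ c) ×-dec (c ≺?ₚ b))
    ... | no nothing-between = a , ≼-refl , a≺b , λ c between → nothing-between (c , between)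
    ... | yes (c , a≺c , c≺b) =
      let d , c≼d , d⋖b = go c (smaller (above-shrinks a≺c)) c≺b
      in  d , ≼-trans (proj₁ a≺c) c≼d , d⋖b

  upper-cover : ∀ {a b} → a ≺ₚ b → ∃ λ c → a ⋖ₚ c × c ≼ b
  upper-cover {a} {b} = go b (<-wellFounded (below b))
    where
    go : ∀ b → Acc _<_ (below b) → a ≺ₚ b → ∃ λ c → a ⋖ₚ c × c ≼ b
    go b (acc smaller) a≺b with any? (λ c → (a ≺?ₚ c) ×-dec (c ≺?ₚ b))
    ... | no nothing-between = b , (a≺b , λ c between → nothing-between (c , between)) , ≼-refl
    ... | yes (c , a≺c , c≺b) =
      let d , a⋖d , d≼c = go c (smaller (below-shrinks c≺b)) a≺c
      in  d , a⋖d , ≼-trans d≼c (proj₁ c≺b)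

module RankFacts (P : FinPoset) (r : Elt P → ℕ) (rk : IsRankFunction P r) where
  open PosetFacts P public
  open Ranked P r public

  cover-rank : ∀ {a b} → a ⋖ₚ b → r b ≡ suc (r a)
  cover-rank = proj₂ rk _ _

  -- Ranks strictly increase along ≺: descend from b through covers.
  rank-strict : ∀ {a b} → a ≺ₚ b → r a < r b
  rank-strict {a} {b} = go b (<-wellFounded (r b))
    where
    go : ∀ b → Acc _<_ (r b) → a ≺ₚ b → r a < r b
    go b (acc smaller) a≺b =
      let c , a≼c , c⋖b = lower-cover a≺b
          rc<rb : r c < r b
          rc<rb = ℕₚ.≤-reflexive (sym (cover-rank c⋖b))
      in  case a Finₚ.≟ c of λ where
            (yes a≡c)  → subst (λ w → r w < r b) (sym a≡c) rc<rb
            (no a≢c)   → ℕₚ.<-trans (go c (smaller rc<rb) (a≼c , a≢c)) rc<rb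

  rank-mono : ∀ {a b} → a ≼ b → r a ≤ r b
  rank-mono {a} {b} a≼b with a Finₚ.≟ b
  ... | yes refl = ℕₚ.≤-refl
  ... | no a≢b   = ℕₚ.<⇒≤ (rank-strict (a≼b , a≢b))

  cover-by-rank : ∀ {y x} → y ≼ x → r x ≡ suc (r y) → y ⋖ₚ x
  cover-by-rank {y} {x} y≼x rx≡ = (y≼x , y≢x) , nothing-between
    where
    y≢x : ¬ y ≡ x
    y≢x refl = ℕₚ.<-irrefl rx≡ (ℕₚ.n<1+n (r y))
    nothing-between : ∀ c → ¬ (y ≺ₚ c × c ≺ₚ x)
    nothing-between c (y≺c , c≺x) =
      ℕₚ.<⇒≱ (rank-strict y≺c) (ℕₚ.≤-pred (subst (r c <_) rx≡ (rank-strict c≺x)))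

  in-interval : ∀ i a b x → Dec (r x ≡ i × a ≼ x × x ≼ b)
  in-interval i a b x = (r x ℕ.≟ i) ×-dec ((a ≼? x) ×-dec (x ≼? b))

  -- Strong regularity extends to all ranks i: outside k ≤ i ≤ l both sides vanish.
  interval-λ : ∀ {λ′} → IsStronglyRegularWith λ′ →
    ∀ {a b} → a ≼ b → ∀ i → interval i a b ≡ λ′ i (r a) (r b)
  interval-λ {λ′} (sreg , λ-vanishes) {a} {b} a≼b i with r a ℕ.≤? i | i ℕ.≤? r b
  ... | yes ra≤i | yes i≤rb = sreg a b a≼b i ra≤i i≤rb
  ... | no ra≰i  | _        = trans (count-none (in-interval i a b) (λ x (rx≡i , a≼x , _) →
                                ra≰i (subst (r a ≤_) rx≡i (rank-mono a≼x))))
                                (sym (λ-vanishes i (r a) (r b) (inj₁ (ℕₚ.≰⇒> ra≰i))))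
  ... | yes _    | no i≰rb  = trans (count-none (in-interval i a b) (λ x (rx≡i , _ , x≼b) →
                                i≰rb (subst (_≤ r b) rx≡i (rank-mono x≼b))))
                                (sym (λ-vanishes i (r a) (r b) (inj₂ (ℕₚ.≰⇒> i≰rb))))

module UPosetFacts (P : FinPoset) (r : Elt P → ℕ) (rk : IsRankFunction P r) (UP : IsUPoset P) where
  open RankFacts P r rk public

  bottom top : Elt P
  bottom = proj₁ (proj₁ UP)
  top    = proj₁ (proj₂ UP)

  bottom-≼ : ∀ x → bottom ≼ x
  bottom-≼ = proj₂ (proj₁ UP)

  ≼-top : ∀ x → x ≼ top
  ≼-top = proj₂ (proj₂ UP)

  rank-bottom : r bottom ≡ 0
  rank-bottom = proj₁ rk bottom (λ x x≼bottom → antisym x≼bottom (bottom-≼ x))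

  only-bottom : ∀ x → r x ≡ r bottom → x ≡ bottom
  only-bottom x rx≡ with x Finₚ.≟ bottom
  ... | yes x≡bottom = x≡bottom
  ... | no x≢bottom  = ⊥-elim (ℕₚ.<-irrefl (sym rx≡) (rank-strict (bottom-≼ x , x≢bottom ∘ sym)))

  only-top : ∀ x → r x ≡ r top → x ≡ top
  only-top x rx≡ with x Finₚ.≟ top
  ... | yes x≡top = x≡top
  ... | no x≢top  = ⊥-elim (ℕₚ.<-irrefl rx≡ (rank-strict (≼-top x , x≢top)))

  N-bottom : N (r bottom) ≡ 1
  N-bottom = count-unique (λ x → r x ℕ.≟ r bottom) bottom refl only-bottom

  N-top : N (r top) ≡ 1
  N-top = count-unique (λ x → r x ℕ.≟ r top) top refl only-top

  downDeg-bottom : downDeg P bottom ≡ 0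
  downDeg-bottom = count-none (_⋖?ₚ bottom) (λ x x⋖bottom → ≺-irrefl (proj₁ x⋖bottom) (bottom-≼ x))

  upDeg-top : upDeg P top ≡ 0
  upDeg-top = count-none (top ⋖?ₚ_) (λ x top⋖x → ≺-irrefl (proj₁ top⋖x) (≼-top x))

  downDeg-nonZero : ∀ {x} → ¬ x ≡ bottom → NonZero (downDeg P x)
  downDeg-nonZero {x} x≢bottom with lower-cover (bottom-≼ x , x≢bottom ∘ sym)
  ... | c , _ , c⋖x = ℕ.>-nonZero (count-some (_⋖?ₚ x) c c⋖x)

  upDeg-nonZero : ∀ {y} → ¬ y ≡ top → NonZero (upDeg P y)
  upDeg-nonZero {y} y≢top with upper-cover (≼-top y , y≢top)
  ... | c , y⋖c , _ = ℕ.>-nonZero (count-some (y ⋖?ₚ_) c y⋖c)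

-- Mass 1 is spread evenly over each rank: share i = 1/N_i,
-- and ω i = 1/(d⁻_i N_i) is what a rank-i element receives through each of its
-- lower covers.
module RegularFacts (P : FinPoset) (r : Elt P → ℕ) (rk : IsRankFunction P r) (UP : IsUPoset P)
                    (d⁻ : ℕ → ℕ) (reg : Ranked.IsRegularWith P r d⁻) where
  open UPosetFacts P r rk UP public

  downDeg-rank : ∀ x → downDeg P x ≡ d⁻ (r x)
  downDeg-rank = proj₂ reg

  -- Rank 0 holds only the bottom, which covers nothing.
  d⁻-bottom : d⁻ (r bottom) ≡ 0
  d⁻-bottom = trans (sym (downDeg-rank bottom)) downDeg-bottom

  d⁻-zero : d⁻ 0 ≡ 0
  d⁻-zero = subst (λ i → d⁻ i ≡ 0) rank-bottom d⁻-bottom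

  -- Counting the covers between ranks r y and suc (r y) from both ends.
  cover-pairs : ∀ y → d⁻ (suc (r y)) ℕ.* N (suc (r y)) ≡ upDeg P y ℕ.* N (r y)
  cover-pairs y = ℕ→ℚ-injective (begin
      ℕ→ℚ (d⁻ (suc i) ℕ.* N (suc i))
    ≡⟨ trans (ℕ→ℚ-* (d⁻ (suc i)) (N (suc i))) (*-comm (ℕ→ℚ (d⁻ (suc i))) (ℕ→ℚ (N (suc i)))) ⟩
      ℕ→ℚ (N (suc i)) * ℕ→ℚ (d⁻ (suc i))
    ≡⟨ sym (∑-constant-on (λ x → r x ℕ.≟ suc i) (λ x → ℕ→ℚ (downDeg P x)) _
              (λ x rx≡ → cong ℕ→ℚ (trans (downDeg-rank x) (cong d⁻ rx≡)))) ⟩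
      ∑[ x < n ] (𝟙 (r x ℕ.≟ suc i) * ℕ→ℚ (downDeg P x))
    ≡⟨ sum-cong-≗ (λ x → trans (cong (𝟙 (r x ℕ.≟ suc i) *_) (count-∑ (_⋖?ₚ x)))
                               (*-distribˡ-sum (𝟙 (r x ℕ.≟ suc i)) (λ z → 𝟙 (z ⋖?ₚ x)))) ⟩
      ∑[ x < n ] ∑[ z < n ] (𝟙 (r x ℕ.≟ suc i) * 𝟙 (z ⋖?ₚ x))
    ≡⟨ sum-cong-≗ (λ x → sum-cong-≗ (λ z → 𝟙-×-cong (r x ℕ.≟ suc i) (z ⋖?ₚ x) (r z ℕ.≟ i) (z ⋖?ₚ x)
          (λ (rx≡ , z⋖x) → ℕₚ.suc-injective (trans (sym (cover-rank z⋖x)) rx≡) , z⋖x)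
          (λ (rz≡ , z⋖x) → trans (cover-rank z⋖x) (cong suc rz≡) , z⋖x))) ⟩
      ∑[ x < n ] ∑[ z < n ] (𝟙 (r z ℕ.≟ i) * 𝟙 (z ⋖?ₚ x))
    ≡⟨ ∑-comm (λ x z → 𝟙 (r z ℕ.≟ i) * 𝟙 (z ⋖?ₚ x)) ⟩
      ∑[ z < n ] ∑[ x < n ] (𝟙 (r z ℕ.≟ i) * 𝟙 (z ⋖?ₚ x))
    ≡⟨ sum-cong-≗ (λ z → trans (sym (*-distribˡ-sum (𝟙 (r z ℕ.≟ i)) (λ x → 𝟙 (z ⋖?ₚ x))))
                               (cong (𝟙 (r z ℕ.≟ i) *_) (sym (count-∑ (z ⋖?ₚ_))))) ⟩
      ∑[ z < n ] (𝟙 (r z ℕ.≟ i) * ℕ→ℚ (upDeg P z))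
    ≡⟨ ∑-constant-on (λ z → r z ℕ.≟ i) (λ z → ℕ→ℚ (upDeg P z)) _
         (λ z rz≡ → cong ℕ→ℚ (proj₁ reg z y rz≡)) ⟩
      ℕ→ℚ (N i) * ℕ→ℚ (upDeg P y)
    ≡⟨ trans (*-comm (ℕ→ℚ (N i)) (ℕ→ℚ (upDeg P y))) (sym (ℕ→ℚ-* (upDeg P y) (N i))) ⟩
      ℕ→ℚ (upDeg P y ℕ.* N i)
    ∎)
    where
    open ≡-Reasoning
    i : ℕ
    i = r y

  share ω : ℕ → ℚ
  share i = inv (N i)
  ω i = inv (d⁻ i ℕ.* N i)

  -- a · 1/(a·b) is 1/b when a ≠ 0; in the exceptional case Φ we have a = 0 and
  -- b = 1, and the indicator of Φ makes up the difference.
  share-split : ∀ a b (q : Dec Φ) → (Φ → a ≡ 0 × b ≡ 1) → (¬ Φ → NonZero a) →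
    ℕ→ℚ a * inv (a ℕ.* b) + 𝟙 q ≡ inv b
  share-split a b (yes q) exceptional _ with exceptional q
  ... | refl , refl = refl
  share-split a b (no ¬q) _ generic = trans (+-identityʳ _) (inv-cancelˡ a b {{generic ¬q}})

  -- What x receives through all its lower covers, plus 1 at the bottom, is its share.
  down-share : ∀ x → ℕ→ℚ (d⁻ (r x)) * ω (r x) + 𝟙 (x Finₚ.≟ bottom) ≡ share (r x)
  down-share x = share-split (d⁻ (r x)) (N (r x)) (x Finₚ.≟ bottom)
    (λ x≡bottom → subst (λ y → d⁻ (r y) ≡ 0 × N (r y) ≡ 1) (sym x≡bottom) (d⁻-bottom , N-bottom))
    (λ x≢bottom → subst NonZero (downDeg-rank x) (downDeg-nonZero x≢bottom))

  outflow : Elt P → ℚ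
  outflow y = ℕ→ℚ (upDeg P y) * ω (suc (r y))

  -- What y sends upwards, plus 1 at the top, is its share.
  up-share : ∀ y → outflow y + 𝟙 (y Finₚ.≟ top) ≡ share (r y)
  up-share y = trans (cong (λ w → ℕ→ℚ (upDeg P y) * inv w + 𝟙 (y Finₚ.≟ top)) (cover-pairs y))
    (share-split (upDeg P y) (N (r y)) (y Finₚ.≟ top)
      (λ y≡top → subst (λ z → upDeg P z ≡ 0 × N (r z) ≡ 1) (sym y≡top) (upDeg-top , N-top))
      upDeg-nonZero)

-- Each element passes its share on to its
-- upper covers; leak x is what x ∈ S receives from lower covers outside S, and
-- inflow x what it receives from lower covers inside S.  Shares are conserved,
-- so the mass entering S from outside (plus 1 if S contains the bottom) equals
-- the mass 1 leaving S at the top.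
module Flow (P : FinPoset) (r : Elt P → ℕ) (rk : IsRankFunction P r) (UP : IsUPoset P)
            (d⁻ : ℕ → ℕ) (reg : Ranked.IsRegularWith P r d⁻)
            (S : Pred (Elt P) 0ℓ) (S? : U.Decidable S)
            (S-up : ∀ {y x} → FinPoset._≼_ P y x → S y → S x) where
  open RegularFacts P r rk UP d⁻ reg public

  outside inside : Elt P → ℕ
  outside x = count (λ y → (y ⋖?ₚ x) ×-dec ¬? (S? y))
  inside  x = count (λ y → (y ⋖?ₚ x) ×-dec S? y)

  leak inflow : Elt P → ℚ
  leak   x = ℕ→ℚ (outside x) * ω (r x)
  inflow x = ℕ→ℚ (inside x) * ω (r x)

  outside+inside : ∀ x → ℕ→ℚ (outside x) + ℕ→ℚ (inside x) ≡ ℕ→ℚ (d⁻ (r x))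
  outside+inside x = trans (sym (ℕ→ℚ-+ (outside x) (inside x)))
    (cong ℕ→ℚ (trans (count-split (_⋖?ₚ x) S?) (downDeg-rank x)))

  share-of : ∀ x → leak x + inflow x + 𝟙 (x Finₚ.≟ bottom) ≡ share (r x)
  share-of x = trans (cong (_+ 𝟙 (x Finₚ.≟ bottom))
                       (trans (sym (*-distribʳ-+ (ω (r x)) (ℕ→ℚ (outside x)) (ℕ→ℚ (inside x))))
                              (cong (_* ω (r x)) (outside+inside x))))
                     (down-share x)

  -- The mass moving inside S, counted at its targets or at its sources (S is an up-set).
  internal-flow : ∑[ x < n ] (𝟙 (S? x) * inflow x) ≡ ∑[ y < n ] (𝟙 (S? y) * outflow y)
  internal-flow = begin
      ∑[ x < n ] (𝟙 (S? x) * inflow x)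
    ≡⟨ sum-cong-≗ expand ⟩
      ∑[ x < n ] ∑[ y < n ] (𝟙 (S? y) * 𝟙 (y ⋖?ₚ x) * ω (r x))
    ≡⟨ ∑-comm (λ x y → 𝟙 (S? y) * 𝟙 (y ⋖?ₚ x) * ω (r x)) ⟩
      ∑[ y < n ] ∑[ x < n ] (𝟙 (S? y) * 𝟙 (y ⋖?ₚ x) * ω (r x))
    ≡⟨ sum-cong-≗ collect ⟩
      ∑[ y < n ] (𝟙 (S? y) * outflow y)
    ∎
    where
    open ≡-Reasoning
    expand : ∀ x → 𝟙 (S? x) * inflow x ≡ ∑[ y < n ] (𝟙 (S? y) * 𝟙 (y ⋖?ₚ x) * ω (r x))
    expand x = begin
        𝟙 (S? x) * (ℕ→ℚ (inside x) * ω (r x))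
      ≡⟨ cong (λ c → 𝟙 (S? x) * (c * ω (r x))) (count-∑ (λ y → (y ⋖?ₚ x) ×-dec S? y)) ⟩
        𝟙 (S? x) * ((∑[ y < n ] 𝟙 ((y ⋖?ₚ x) ×-dec S? y)) * ω (r x))
      ≡⟨ trans (cong (𝟙 (S? x) *_) (*-distribʳ-sum (ω (r x)) (λ y → 𝟙 ((y ⋖?ₚ x) ×-dec S? y))))
               (*-distribˡ-sum (𝟙 (S? x)) (λ y → 𝟙 ((y ⋖?ₚ x) ×-dec S? y) * ω (r x))) ⟩
        ∑[ y < n ] (𝟙 (S? x) * (𝟙 ((y ⋖?ₚ x) ×-dec S? y) * ω (r x)))
      ≡⟨ sum-cong-≗ (λ y → trans (sym (*-assoc (𝟙 (S? x)) (𝟙 ((y ⋖?ₚ x) ×-dec S? y)) (ω (r x)))) (cong (_* ω (r x))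
           (𝟙-×-cong (S? x) ((y ⋖?ₚ x) ×-dec S? y) (S? y) (y ⋖?ₚ x)
             (λ (_ , y⋖x , Sy) → Sy , y⋖x) (λ (Sy , y⋖x) → S-up (⋖⇒≼ y⋖x) Sy , y⋖x , Sy)))) ⟩
        ∑[ y < n ] (𝟙 (S? y) * 𝟙 (y ⋖?ₚ x) * ω (r x))
      ∎
    collect : ∀ y → ∑[ x < n ] (𝟙 (S? y) * 𝟙 (y ⋖?ₚ x) * ω (r x)) ≡ 𝟙 (S? y) * outflow y
    collect y = begin
        ∑[ x < n ] (𝟙 (S? y) * 𝟙 (y ⋖?ₚ x) * ω (r x))
      ≡⟨ sum-cong-≗ (λ x → *-assoc (𝟙 (S? y)) (𝟙 (y ⋖?ₚ x)) (ω (r x))) ⟩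
        ∑[ x < n ] (𝟙 (S? y) * (𝟙 (y ⋖?ₚ x) * ω (r x)))
      ≡⟨ sym (*-distribˡ-sum (𝟙 (S? y)) (λ x → 𝟙 (y ⋖?ₚ x) * ω (r x))) ⟩
        𝟙 (S? y) * ∑[ x < n ] (𝟙 (y ⋖?ₚ x) * ω (r x))
      ≡⟨ cong (𝟙 (S? y) *_) (∑-constant-on (y ⋖?ₚ_) (λ x → ω (r x)) _ (λ x y⋖x → cong ω (cover-rank y⋖x))) ⟩
        𝟙 (S? y) * outflow y
      ∎

  mass : ℚ
  mass = ∑[ x < n ] (𝟙 (S? x) * share (r x))

  mass-at-targets : mass ≡ ∑[ x < n ] (𝟙 (S? x) * leak x) + ∑[ x < n ] (𝟙 (S? x) * inflow x) + 𝟙 (S? bottom)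
  mass-at-targets = begin
      mass
    ≡⟨ sum-cong-≗ (λ x → cong (𝟙 (S? x) *_) (sym (share-of x))) ⟩
      ∑[ x < n ] (𝟙 (S? x) * (leak x + inflow x + 𝟙 (x Finₚ.≟ bottom)))
    ≡⟨ ∑-split (λ x → 𝟙 (S? x)) (λ x → leak x + inflow x) (λ x → 𝟙 (x Finₚ.≟ bottom)) ⟩
      ∑[ x < n ] (𝟙 (S? x) * (leak x + inflow x)) + ∑[ x < n ] (𝟙 (S? x) * 𝟙 (x Finₚ.≟ bottom))
    ≡⟨ cong₂ _+_ (∑-split (λ x → 𝟙 (S? x)) leak inflow) (∑-point (λ x → 𝟙 (S? x)) bottom) ⟩
      ∑[ x < n ] (𝟙 (S? x) * leak x) + ∑[ x < n ] (𝟙 (S? x) * inflow x) + 𝟙 (S? bottom)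
    ∎
    where open ≡-Reasoning

  -- The mass of S, counted at the sources of the flow; a nonempty up-set contains the top.
  mass-at-sources : ∃ S → mass ≡ ∑[ x < n ] (𝟙 (S? x) * inflow x) + 1ℚ
  mass-at-sources (s , s∈S) = begin
      mass
    ≡⟨ sum-cong-≗ (λ y → cong (𝟙 (S? y) *_) (sym (up-share y))) ⟩
      ∑[ y < n ] (𝟙 (S? y) * (outflow y + 𝟙 (y Finₚ.≟ top)))
    ≡⟨ ∑-split (λ y → 𝟙 (S? y)) outflow (λ y → 𝟙 (y Finₚ.≟ top)) ⟩
      ∑[ y < n ] (𝟙 (S? y) * outflow y) + ∑[ y < n ] (𝟙 (S? y) * 𝟙 (y Finₚ.≟ top))
    ≡⟨ cong₂ _+_ (sym internal-flow) (trans (∑-point (λ y → 𝟙 (S? y)) top) (𝟙-yes (S? top) (S-up (≼-top s) s∈S))) ⟩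
      ∑[ x < n ] (𝟙 (S? x) * inflow x) + 1ℚ
    ∎
    where open ≡-Reasoning

  flow : ∃ S → 𝟙 (S? bottom) + ∑[ x < n ] (𝟙 (S? x) * leak x) ≡ 1ℚ
  flow S≢∅ = begin
      B + L            ≡⟨ rearrange B L I ⟩
      L + I + B - I    ≡⟨ cong (_- I) (trans (sym mass-at-targets) (mass-at-sources S≢∅)) ⟩
      I + 1ℚ - I       ≡⟨ cancel I ⟩
      1ℚ               ∎
    where
    open ≡-Reasoning
    open +-*-Solver
    B L I : ℚ
    B = 𝟙 (S? bottom)
    L = ∑[ x < n ] (𝟙 (S? x) * leak x)
    I = ∑[ x < n ] (𝟙 (S? x) * inflow x)
    rearrange : ∀ B L I → B + L ≡ L + I + B - I
    rearrange = solve 3 (λ B L I → B :+ L := L :+ I :+ B :- I) refl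
    cancel : ∀ I → I + 1ℚ - I ≡ 1ℚ
    cancel = solve 1 (λ I → I :+ con 1ℚ :- I := con 1ℚ) refl

-- Then U(A) is the
-- disjoint union of the intervals [A i, B i] and U(A) ∖ D(B); the leak summed
-- over [A i, B i] is β(k_i, l_i) minus the (k_i = 0) correction, and the leak
-- over U(A) ∖ D(B) is the weight sum of the theorem.
module Antichains (P : FinPoset) (r : Elt P → ℕ) (rk : IsRankFunction P r) (UP : IsUPoset P)
                  (d⁻ : ℕ → ℕ) (λ′ : ℕ → ℕ → ℕ → ℕ)
                  (reg : Ranked.IsRegularWith P r d⁻) (sreg : Ranked.IsStronglyRegularWith P r λ′)
                  {m : ℕ} (A B : Fin m → Elt P)
                  (A≼B⇔ : ∀ i j → FinPoset._≼_ P (A i) (B j) ⇔ (i ≡ j)) where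

  private
    AboveA : Pred (Elt P) 0ℓ
    AboveA x = ∃ λ i → FinPoset._≼_ P (A i) x

    AboveA-up : ∀ {y x} → FinPoset._≼_ P y x → AboveA y → AboveA x
    AboveA-up y≼x (i , Ai≼y) = i , PosetFacts.≼-trans P Ai≼y y≼x

  open Flow P r rk UP d⁻ reg AboveA (Ranked.Sets.inUp? P r A B) AboveA-up public
  open Sets A B public

  owner : ∀ {i j x} → A j ≼ x → x ≼ B i → j ≡ i
  owner Aj≼x x≼Bi = Equivalence.to (A≼B⇔ _ _) (≼-trans Aj≼x x≼Bi)

  A≼B : ∀ i → A i ≼ B i
  A≼B i = Equivalence.from (A≼B⇔ i i) refl

  I? : ∀ i x → Dec (A i ≼ x × x ≼ B i)
  I? i x = (A i ≼? x) ×-dec (x ≼? B i)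

  W-outside : ∀ x → AboveA x → W x ≡ outside x
  W-outside x x∈U with inUp? x
  ... | no x∉U = ⊥-elim (x∉U x∈U)
  ... | yes _  = count-cong W? (λ y → (y ⋖?ₚ x) ×-dec ¬? (inUp? y))
      (λ y ((y≼x , rx≡) , ∉U) → cover-by-rank y≼x (sym rx≡) , λ (i , Ai≼y) → ∉U (i , ≼-trans Ai≼y y≼x , Ai≼y))
      (λ y (y⋖x , ∉U) → (⋖⇒≼ y⋖x , sym (cover-rank y⋖x)) , λ (i , _ , Ai≼y) → ∉U (i , Ai≼y))
    where
    W? : ∀ y → Dec (((y ≼ x) × suc (r y) ≡ r x) × ¬ (∃ λ i → A i ≼ x × A i ≼ y))
    W? y = ((y ≼? x) ×-dec (suc (r y) ℕ.≟ r x)) ×-dec ¬? (any? (λ i → (A i ≼? x) ×-dec (A i ≼? y)))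

  weightSum-leak : weightSum d⁻ ≡ ∑[ x < n ] (𝟙 (inDiff? x) * leak x)
  weightSum-leak = trans (sumℚ-filter inDiff? (λ x → ℕ→ℚ (W x) /ℕ (d⁻ (r x) ℕ.* N (r x))))
    (sum-cong-≗ (λ x → 𝟙-guard (inDiff? x) (λ (x∈U , _) →
       trans (/ℕ-as-* (ℕ→ℚ (W x)) (d⁻ (r x) ℕ.* N (r x))) (cong (λ w → ℕ→ℚ w * ω (r x)) (W-outside x x∈U)))))

  partition : ∀ x → ∑[ i < m ] 𝟙 (I? i x) + 𝟙 (inDiff? x) ≡ 𝟙 (inUp? x)
  partition x = by-cases (inUp? x) (inDown? x)
    where
    by-cases : Dec (AboveA x) → Dec (∃ λ j → x ≼ B j) → ∑[ i < m ] 𝟙 (I? i x) + 𝟙 (inDiff? x) ≡ 𝟙 (inUp? x)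
    by-cases (yes (i , Ai≼x)) (yes (j , x≼Bj)) = begin
        ∑[ k < m ] 𝟙 (I? k x) + 𝟙 (inDiff? x)
      ≡⟨ cong₂ _+_ (∑-single (λ k → 𝟙 (I? k x)) i (λ k k≢i → 𝟙-no (I? k x) λ (Ak≼x , _) →
                      k≢i (trans (owner Ak≼x x≼Bj) (sym (owner Ai≼x x≼Bj)))))
                   (𝟙-no (inDiff? x) (λ (_ , ∉D) → ∉D (j , x≼Bj))) ⟩
        𝟙 (I? i x) + 0ℚ
      ≡⟨ trans (+-identityʳ _) (𝟙-yes (I? i x) (Ai≼x , subst (λ k → x ≼ B k) (sym (owner Ai≼x x≼Bj)) x≼Bj)) ⟩
        1ℚ
      ≡⟨ sym (𝟙-yes (inUp? x) (i , Ai≼x)) ⟩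
        𝟙 (inUp? x)
      ∎
      where open ≡-Reasoning
    by-cases (yes x∈U) (no x∉D) =
      trans (cong₂ _+_ (∑-zero (λ k → 𝟙-no (I? k x) (λ (_ , x≼Bk) → x∉D (k , x≼Bk))))
                       (𝟙-yes (inDiff? x) (x∈U , x∉D)))
            (trans (+-identityˡ 1ℚ) (sym (𝟙-yes (inUp? x) x∈U)))
    by-cases (no x∉U) _ =
      trans (cong₂ _+_ (∑-zero (λ k → 𝟙-no (I? k x) (λ (Ak≼x , _) → x∉U (k , Ak≼x))))
                       (𝟙-no (inDiff? x) (x∉U ∘ proj₁)))
            (trans (+-identityˡ 0ℚ) (sym (𝟙-no (inUp? x) x∉U)))

  partition-sum : ∀ (f : Elt P → ℚ) →
    ∑[ i < m ] ∑[ x < n ] (𝟙 (I? i x) * f x) + ∑[ x < n ] (𝟙 (inDiff? x) * f x) ≡ ∑[ x < n ] (𝟙 (inUp? x) * f x)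
  partition-sum f = begin
      ∑[ i < m ] ∑[ x < n ] (𝟙 (I? i x) * f x) + ∑[ x < n ] (𝟙 (inDiff? x) * f x)
    ≡⟨ cong (_+ ∑[ x < n ] (𝟙 (inDiff? x) * f x))
         (trans (∑-comm (λ i x → 𝟙 (I? i x) * f x)) (sum-cong-≗ (λ x → sym (*-distribʳ-sum (f x) (λ i → 𝟙 (I? i x)))))) ⟩
      ∑[ x < n ] ((∑[ i < m ] 𝟙 (I? i x)) * f x) + ∑[ x < n ] (𝟙 (inDiff? x) * f x)
    ≡⟨ sym (∑-distrib-+ (λ x → (∑[ i < m ] 𝟙 (I? i x)) * f x) (λ x → 𝟙 (inDiff? x) * f x)) ⟩
      ∑[ x < n ] ((∑[ i < m ] 𝟙 (I? i x)) * f x + 𝟙 (inDiff? x) * f x)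
    ≡⟨ sum-cong-≗ (λ x → trans (sym (*-distribʳ-+ (f x) (∑[ i < m ] 𝟙 (I? i x)) (𝟙 (inDiff? x)))) (cong (_* f x) (partition x))) ⟩
      ∑[ x < n ] (𝟙 (inUp? x) * f x)
    ∎
    where open ≡-Reasoning

  -- The intervals starting at rank 0 are those starting at the bottom; at most one of them exists.
  bottoms : ∑[ i < m ] 𝟙 (r (A i) ℕ.≟ 0) ≡ 𝟙 (inUp? bottom)
  bottoms with inUp? bottom
  ... | yes (i , Ai≼bottom) =
    trans (∑-single (λ k → 𝟙 (r (A k) ℕ.≟ 0)) i (λ k k≢i → 𝟙-no (r (A k) ℕ.≟ 0) λ rAk≡0 →
            k≢i (owner (subst (_≼ B i) (sym (at-bottom rAk≡0)) (bottom-≼ (B i))) (≼-refl {B i}))))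
          (𝟙-yes (r (A i) ℕ.≟ 0) (trans (cong r (antisym Ai≼bottom (bottom-≼ (A i)))) rank-bottom))
    where
    at-bottom : ∀ {k} → r (A k) ≡ 0 → A k ≡ bottom
    at-bottom rAk≡0 = only-bottom _ (trans rAk≡0 (sym rank-bottom))
  ... | no bottom∉U =
    ∑-zero (λ k → 𝟙-no (r (A k) ℕ.≟ 0) λ rAk≡0 →
      bottom∉U (k , ≼-reflexive (only-bottom (A k) (trans rAk≡0 (sym rank-bottom)))))

  -- For x ∈ [A i, B i], a lower cover of x lies in U(A) exactly when it lies
  -- above A i, so the inner covers of x are counted by strong regularity.
  inside-interval : ∀ {i x t} → A i ≼ x → x ≼ B i → r x ≡ suc t → inside x ≡ λ′ t (r (A i)) (r x)
  inside-interval {i} {x} {t} Ai≼x x≼Bi rx≡ =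
    trans (count-cong (λ y → (y ⋖?ₚ x) ×-dec inUp? y) (in-interval t (A i) x)
            (λ y (y⋖x , j , Aj≼y) → ℕₚ.suc-injective (trans (sym (cover-rank y⋖x)) rx≡)
                                   , subst (λ k → A k ≼ y) (owner (≼-trans Aj≼y (⋖⇒≼ y⋖x)) x≼Bi) Aj≼y
                                   , ⋖⇒≼ y⋖x)
            (λ y (ry≡ , Ai≼y , y≼x) → cover-by-rank y≼x (trans rx≡ (cong suc (sym ry≡))) , i , Ai≼y))
          (interval-λ sreg Ai≼x t)

  layer : Fin m → ℕ → ℚ
  layer i t = ∑[ x < n ] (𝟙 (r x ℕ.≟ t) * (𝟙 (I? i x) * leak x))

  leak-in-interval : ∀ {i x t t′} → A i ≼ x → x ≼ B i → r x ≡ t → t ≡ suc t′ →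
    leak x ≡ (ℕ→ℚ (d⁻ t) - ℕ→ℚ (λ′ t′ (r (A i)) t)) * ω t
  leak-in-interval {i} {x} {t} {t′} Ai≼x x≼Bi rx≡t t≡ = begin
      ℕ→ℚ (outside x) * ω (r x)
    ≡⟨ cong (_* ω (r x)) (+-move-right {ℕ→ℚ (outside x)} {ℕ→ℚ (inside x)} (outside+inside x)) ⟩
      (ℕ→ℚ (d⁻ (r x)) - ℕ→ℚ (inside x)) * ω (r x)
    ≡⟨ cong (λ c → (ℕ→ℚ (d⁻ (r x)) - ℕ→ℚ c) * ω (r x)) (inside-interval Ai≼x x≼Bi (trans rx≡t t≡)) ⟩
      (ℕ→ℚ (d⁻ (r x)) - ℕ→ℚ (λ′ t′ (r (A i)) (r x))) * ω (r x)
    ≡⟨ cong (λ s → (ℕ→ℚ (d⁻ s) - ℕ→ℚ (λ′ t′ (r (A i)) s)) * ω s) rx≡t ⟩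
      (ℕ→ℚ (d⁻ t) - ℕ→ℚ (λ′ t′ (r (A i)) t)) * ω t
    ∎
    where open ≡-Reasoning

  -- Layer t of [A i, B i] has λ_t(k, l) elements, each leaking the same amount:
  -- this is the summand of β(k, l) for rank t.
  layer-formula : ∀ i {k t t′} → r (A i) ≡ k → t ≡ suc t′ →
    layer i t ≡ (ℕ→ℚ (λ′ t k (r (B i))) /ℕ (d⁻ t ℕ.* N t)) * (ℕ→ℚ (d⁻ t) - ℕ→ℚ (λ′ t′ k t))
  layer-formula i {t = t} {t′} refl t≡ = begin
      layer i t
    ≡⟨ sum-cong-≗ (λ x → trans (sym (*-assoc (𝟙 (r x ℕ.≟ t)) (𝟙 (I? i x)) (leak x)))
                               (cong (_* leak x) (sym (𝟙-× (r x ℕ.≟ t) (I? i x))))) ⟩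
      ∑[ x < n ] (𝟙 (in-interval t (A i) (B i) x) * leak x)
    ≡⟨ ∑-constant-on (in-interval t (A i) (B i)) leak (D * ω t)
         (λ x (rx≡t , Ai≼x , x≼Bi) → leak-in-interval Ai≼x x≼Bi rx≡t t≡) ⟩
      ℕ→ℚ (interval t (A i) (B i)) * (D * ω t)
    ≡⟨ cong (λ c → ℕ→ℚ c * (D * ω t)) (interval-λ sreg (A≼B i) t) ⟩
      ℕ→ℚ Λ * (D * ω t)
    ≡⟨ regroup (ℕ→ℚ Λ) D (ω t) ⟩
      ℕ→ℚ Λ * ω t * D
    ≡⟨ cong (_* D) (sym (/ℕ-as-* (ℕ→ℚ Λ) (d⁻ t ℕ.* N t))) ⟩
      (ℕ→ℚ Λ /ℕ (d⁻ t ℕ.* N t)) * D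
    ∎
    where
    open ≡-Reasoning
    open +-*-Solver
    Λ : ℕ
    Λ = λ′ t (r (A i)) (r (B i))
    D : ℚ
    D = ℕ→ℚ (d⁻ t) - ℕ→ℚ (λ′ t′ (r (A i)) t)
    regroup : ∀ a b c → a * (b * c) ≡ a * c * b
    regroup = solve 3 (λ a b c → a :* (b :* c) := a :* c :* b) refl

  -- Nothing leaks on rank 0, since d⁻_0 = 0 and 1/0 = 0.
  layer-zero : ∀ i → layer i 0 ≡ 0ℚ
  layer-zero i = ∑-zero (λ x → trans (𝟙-guard (r x ℕ.≟ 0) (λ rx≡0 →
      trans (cong (𝟙 (I? i x) *_) (no-leak rx≡0)) (*-zeroʳ (𝟙 (I? i x)))))
    (*-zeroʳ (𝟙 (r x ℕ.≟ 0))))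
    where
    no-leak : ∀ {x} → r x ≡ 0 → leak x ≡ 0ℚ
    no-leak {x} rx≡0 = trans (cong (λ s → ℕ→ℚ (outside x) * inv (d⁻ s ℕ.* N s)) rx≡0)
      (trans (cong (λ d → ℕ→ℚ (outside x) * inv (d ℕ.* N 0)) d⁻-zero) (*-zeroʳ (ℕ→ℚ (outside x))))

  βterm-head : ∀ i k → r (A i) ≡ k → βterm d⁻ λ′ k (r (B i)) 0 ≡ 𝟙 (k ℕ.≟ 0) + layer i (k ℕ.+ 0)
  βterm-head i zero    _      = sym (trans (cong (1ℚ +_) (layer-zero i)) (+-identityʳ 1ℚ))
  βterm-head i (suc k) rAi≡ = sym (trans (+-identityˡ _)
    (trans (cong (layer i) (ℕₚ.+-identityʳ (suc k))) (layer-formula i rAi≡ refl)))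

  βterm-tail : ∀ i k j → r (A i) ≡ k → βterm d⁻ λ′ k (r (B i)) (suc j) ≡ layer i (k ℕ.+ suc j)
  βterm-tail i zero    j rAi≡ = sym (layer-formula i rAi≡ refl)
  βterm-tail i (suc k) j rAi≡ = sym (layer-formula i rAi≡ (ℕₚ.+-suc (suc k) j))

  layers-cover : ∀ i → let k = r (A i); l = r (B i) in
    ∑[ j < suc (l ℕ.∸ k) ] layer i (k ℕ.+ toℕ j) ≡ ∑[ x < n ] (𝟙 (I? i x) * leak x)
  layers-cover i = begin
      ∑[ j < L ] ∑[ x < n ] (𝟙 (r x ℕ.≟ k ℕ.+ toℕ j) * (𝟙 (I? i x) * leak x))
    ≡⟨ ∑-comm (λ (j : Fin L) (x : Elt P) → 𝟙 (r x ℕ.≟ k ℕ.+ toℕ j) * (𝟙 (I? i x) * leak x)) ⟩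
      ∑[ x < n ] ∑[ j < L ] (𝟙 (r x ℕ.≟ k ℕ.+ toℕ j) * (𝟙 (I? i x) * leak x))
    ≡⟨ sum-cong-≗ one-layer-each ⟩
      ∑[ x < n ] (𝟙 (I? i x) * leak x)
    ∎
    where
    open ≡-Reasoning
    k l L : ℕ
    k = r (A i)
    l = r (B i)
    L = suc (l ℕ.∸ k)
    one-layer-each : ∀ x → ∑[ j < L ] (𝟙 (r x ℕ.≟ k ℕ.+ toℕ j) * (𝟙 (I? i x) * leak x)) ≡ 𝟙 (I? i x) * leak x
    one-layer-each x = trans (sym (*-distribʳ-sum (𝟙 (I? i x) * leak x) (λ (j : Fin L) → 𝟙 (r x ℕ.≟ k ℕ.+ toℕ j))))
      (𝟙-absorb (I? i x) {∑[ j < L ] 𝟙 (r x ℕ.≟ k ℕ.+ toℕ j)} (leak x) (λ (Ai≼x , x≼Bi) →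
        ∑-hit {k} {r x} {l ℕ.∸ k} (rank-mono Ai≼x)
          (subst (r x ≤_) (sym (ℕₚ.m+[n∸m]≡n (rank-mono (A≼B i)))) (rank-mono x≼Bi))))

  β-decomposition : ∀ i → β d⁻ λ′ (r (A i)) (r (B i)) ≡ 𝟙 (r (A i) ℕ.≟ 0) + ∑[ x < n ] (𝟙 (I? i x) * leak x)
  β-decomposition i = begin
      β d⁻ λ′ k l
    ≡⟨ sumℚ-upTo (βterm d⁻ λ′ k l) (suc (l ℕ.∸ k)) ⟩
      βterm d⁻ λ′ k l 0 + ∑[ j < l ℕ.∸ k ] βterm d⁻ λ′ k l (suc (toℕ j))
    ≡⟨ cong₂ _+_ (βterm-head i k refl) (sum-cong-≗ {l ℕ.∸ k} (λ j → βterm-tail i k (toℕ j) refl)) ⟩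
      𝟙 (k ℕ.≟ 0) + layer i (k ℕ.+ 0) + ∑[ j < l ℕ.∸ k ] layer i (k ℕ.+ suc (toℕ j))
    ≡⟨ +-assoc (𝟙 (k ℕ.≟ 0)) (layer i (k ℕ.+ 0)) _ ⟩
      𝟙 (k ℕ.≟ 0) + ∑[ j < suc (l ℕ.∸ k) ] layer i (k ℕ.+ toℕ j)
    ≡⟨ cong (𝟙 (k ℕ.≟ 0) +_) (layers-cover i) ⟩
      𝟙 (k ℕ.≟ 0) + ∑[ x < n ] (𝟙 (I? i x) * leak x)
    ∎
    where
    open ≡-Reasoning
    k l : ℕ
    k = r (A i)
    l = r (B i)

-- Theorem 2.  Summing β over the intervals and the weights over U(A) ∖ D(B)
-- reassembles the leak over U(A) (partition-sum), with the k_i = 0 corrections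
-- adding up to the indicator of bottom ∈ U(A) (bottoms); the flow identity
-- for the nonempty up-set U(A) then gives 1.
theorem2 : (P : FinPoset) (r : Elt P → ℕ) (d⁻ : ℕ → ℕ) (λ' : ℕ → ℕ → ℕ → ℕ)
  → IsRankFunction P r
  → IsUPoset P
  → Ranked.IsRegularWith P r d⁻
  → Ranked.IsStronglyRegularWith P r λ'
  → (m : ℕ) → 1 ≤ m
  → (A B : Fin m → Elt P)
  → (∀ i j → (FinPoset._≼_ P (A i) (B j)) ⇔ (i ≡ j))
  → sumℚ (map (λ i → Ranked.β P r d⁻ λ' (r (A i)) (r (B i))) (allFin m))
      + Ranked.Sets.weightSum P r A B d⁻
    ≡ 1ℚ
theorem2 P r d⁻ λ' rk UP reg sreg m 1≤m A B A≼B⇔ = begin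
    sumℚ (map (λ i → β d⁻ λ' (r (A i)) (r (B i))) (allFin m)) + weightSum d⁻
  ≡⟨ cong₂ _+_ (trans (sumℚ-allFin (λ i → β d⁻ λ' (r (A i)) (r (B i)))) (sum-cong-≗ β-decomposition)) weightSum-leak ⟩
    ∑[ i < m ] (𝟙 (r (A i) ℕ.≟ 0) + Leak i) + ∑[ x < n ] (𝟙 (inDiff? x) * leak x)
  ≡⟨ cong (_+ ∑[ x < n ] (𝟙 (inDiff? x) * leak x)) (∑-distrib-+ (λ i → 𝟙 (r (A i) ℕ.≟ 0)) Leak) ⟩
    ∑[ i < m ] 𝟙 (r (A i) ℕ.≟ 0) + ∑[ i < m ] Leak i + ∑[ x < n ] (𝟙 (inDiff? x) * leak x)
  ≡⟨ +-assoc (∑[ i < m ] 𝟙 (r (A i) ℕ.≟ 0)) _ _ ⟩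
    ∑[ i < m ] 𝟙 (r (A i) ℕ.≟ 0) + (∑[ i < m ] Leak i + ∑[ x < n ] (𝟙 (inDiff? x) * leak x))
  ≡⟨ cong₂ _+_ bottoms (partition-sum leak) ⟩
    𝟙 (inUp? bottom) + ∑[ x < n ] (𝟙 (inUp? x) * leak x)
  ≡⟨ flow (A (fromℕ< 1≤m) , fromℕ< 1≤m , ≼-refl) ⟩
    1ℚ
  ∎
  where
  open ≡-Reasoning
  open Antichains P r rk UP d⁻ λ' reg sreg A B A≼B⇔
  Leak : Fin m → ℚ
  Leak i = ∑[ x < n ] (𝟙 (I? i x) * leak x)
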